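{- If $v \equiv 10 \pmod{12}$, then there is no minimum uniform nested SQS$(v)$; i.e., if a minimum uniform nested SQS$(v)$ exists, then $v \equiv 4 \pmod{12}$.
   Context: A Steiner quadruple system SQS$(v)$ is a pair $(Q,\mathcal{B})$ where $Q$ is a set of $v$ points and $\mathcal{B}$ is a collection of 4-subsets of $Q$ (blocks) such that every 3-subset of $Q$ is contained in exactly one block. A nested SQS$(v)$ is an SQS$(v)$ together with a partition of each block into two 2-subsets (pairs). A pair of points is an ND-pair if it is one of the two pairs in the partition of at least one block; the multiplicity of a pair is the number of blocks whose partition contains that pair. A nested SQS is uniform if all its ND-pairs have the same multiplicity. A minimum uniform nested SQS$(v)$ is a uniform nested SQS$(v)$ with exactly $\frac{v}{2}\left(\frac{v}{2}-1\right)$ ND-pairs. -}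

module Defs where

open import Data.Nat using (ℕ; zero; suc; _+_; _*_; _≤_; _<_)
import Data.Nat as ℕ
open import Data.Nat.DivMod using (_%_)
open import Data.Fin using (Fin; toℕ)
open import Data.Fin.Properties using (_≟_)
open import Data.List using (List; []; _∷_; length; filter; cartesianProduct; allFin; lookup)
open import Data.Product using (Σ; _×_; _,_; proj₁; proj₂)
open import Data.Sum using (_⊎_)
open import Relation.Binary.PropositionalEquality using (_≡_)
open import Relation.Nullary using (¬_; Dec)
open import Relation.Nullary.Decidable using (_×-dec_; _⊎-dec_)

-- A nested block on point set Fin v: four distinct points a b c d,
-- i.e. the block {a,b,c,d} partitioned into the two pairs {a,b} and {c,d}.
record NestedBlock (v : ℕ) : Set where
  field
    a b c d : Fin v
    a≢b : ¬ a ≡ b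
    a≢c : ¬ a ≡ c
    a≢d : ¬ a ≡ d
    b≢c : ¬ b ≡ c
    b≢d : ¬ b ≡ d
    c≢d : ¬ c ≡ d

open NestedBlock public

module _ {v : ℕ} where

  _∈B_ : Fin v → NestedBlock v → Set
  x ∈B B = x ≡ a B ⊎ x ≡ b B ⊎ x ≡ c B ⊎ x ≡ d B

  TripleIn : Fin v → Fin v → Fin v → NestedBlock v → Set
  TripleIn x y z B = x ∈B B × y ∈B B × z ∈B B

  SamePair : Fin v → Fin v → Fin v → Fin v → Set
  SamePair x y p q = (x ≡ p × y ≡ q) ⊎ (x ≡ q × y ≡ p)

  samePair? : ∀ x y p q → Dec (SamePair x y p q)
  samePair? x y p q = ((x ≟ p) ×-dec (y ≟ q)) ⊎-dec ((x ≟ q) ×-dec (y ≟ p))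

  PairOf : Fin v → Fin v → NestedBlock v → Set
  PairOf x y B = SamePair x y (a B) (b B) ⊎ SamePair x y (c B) (d B)

  pairOf? : ∀ x y B → Dec (PairOf x y B)
  pairOf? x y B = samePair? x y (a B) (b B) ⊎-dec samePair? x y (c B) (d B)

IsNestedSQS : (v : ℕ) → List (NestedBlock v) → Set
IsNestedSQS v 𝓑 =
  (x y z : Fin v) → ¬ x ≡ y → ¬ x ≡ z → ¬ y ≡ z →
  Σ (Fin (length 𝓑)) λ i →
    TripleIn x y z (lookup 𝓑 i) ×
    ((j : Fin (length 𝓑)) → TripleIn x y z (lookup 𝓑 j) → j ≡ i)

multiplicity : {v : ℕ} → List (NestedBlock v) → Fin v → Fin v → ℕ
multiplicity 𝓑 x y = length (filter (pairOf? x y) 𝓑)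

IsNDPair : {v : ℕ} → List (NestedBlock v) → Fin v → Fin v → Set
IsNDPair 𝓑 x y = ¬ x ≡ y × 1 ≤ multiplicity 𝓑 x y

numNDPairs : {v : ℕ} → List (NestedBlock v) → ℕ
numNDPairs {v} 𝓑 =
  length (filter (λ p → (toℕ (proj₁ p) ℕ.<? toℕ (proj₂ p))
                         ×-dec (1 ℕ.≤? multiplicity 𝓑 (proj₁ p) (proj₂ p)))
                 (cartesianProduct (allFin v) (allFin v)))

IsUniform : {v : ℕ} → List (NestedBlock v) → Set
IsUniform {v} 𝓑 = Σ ℕ λ m → (x y : Fin v) → IsNDPair 𝓑 x y → multiplicity 𝓑 x y ≡ m

-- minimum uniform nested SQS(v): uniform, with exactly (v/2)(v/2 - 1) ND-pairs.
-- (v/2)(v/2 - 1) = N  ⇔  v² - 2v = 4N  ⇔  4N + 2v = v·v  (exact over ℕ, any v)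
IsMinUniformNestedSQS : (v : ℕ) → List (NestedBlock v) → Set
IsMinUniformNestedSQS v 𝓑 =
  IsNestedSQS v 𝓑 × IsUniform 𝓑 × 4 * numNDPairs 𝓑 + 2 * v ≡ v * v

{-# OPTIONS --safe #-}
-- Write v = 2n with n odd. For a point x let d(x) be the number of its ND-partners and
-- q(x) = v - 1 - d(x) the number of its non-partners. For distinct x, y, z let fourth x y z be the
-- fourth point of the block through them: w ↦ fourth x y w is an involution, and the partner of x
-- in that block makes one of y, w, fourth x y w an ND-partner of x. So for a non-partner z,
-- w ↦ fourth x z w injects the other non-partners into the partners, and q(x) ≤ d(x) + 1.
-- With only n(n - 1) ND-pairs the degrees d sum to 2n(n - 1), so some x has d(x) < n, which
-- forces q(x) = n = d(x) + 1. Take a partner y of x. If fourth x y maps non-partners to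
-- non-partners, it pairs them off and n is even. Otherwise it sends a non-partner w to a partner p;
-- then fourth x w swaps y and p, so it injects the non-partners other than w into the partners
-- other than y and p, and q(x) ≤ d(x) - 1.
module Submission where

open import Defs
open import Data.Nat using (ℕ; zero; suc; _+_; _*_; _≤_; _<_; z≤n; s≤s; _≤?_; _<?_)
open import Data.Nat.DivMod using (_%_; _/_; m≡m%n+[m/n]*n)
open import Data.List using (List; length; filter; tabulate; cartesianProduct; map; _++_; lookup)
open import Data.Product using (Σ; ∃; _×_; _,_; proj₁; proj₂)
open import Relation.Binary.PropositionalEquality
  using (_≡_; _≢_; refl; sym; trans; cong; cong₂; subst; ≢-sym; module ≡-Reasoning)
open import Relation.Nullary using (¬_; Dec; yes; no; does; contradiction)

open import Data.Bool using (if_then_else_; true; false)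
open import Data.Empty using (⊥-elim)
open import Data.Fin using (Fin; zero; suc; toℕ)
open import Data.Fin.Properties using (_≟_; any?; toℕ-injective; suc-injective; 0≢1+n; injective⇒≤)
open import Data.List.Properties using (filter-++; length-++; map-tabulate; filter-≐; filter-none; filter-some)
import Data.List.Membership.Propositional as ListMembership
import Data.List.Membership.Propositional.Properties as ListMembership
import Data.List.Relation.Unary.All as ListAll
open import Data.Nat.Divisibility using (_∣_; divides; _∣?_; ∣-trans; n∣m*n; ∣m+n∣m⇒∣n)
open import Data.Nat.Properties
  using ( +-0-commutativeMonoid; +-comm; +-identityʳ; *-comm; *-distribˡ-+
        ; ≤-reflexive; ≤-trans; ≤-antisym; ≤-pred; n≤1+n; m≤m+n; m≤n+m; 1+n≰n; ≮⇒≥; <⇒≱; m<m+n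
        ; +-mono-≤; +-monoˡ-≤; +-cancelˡ-≤; <-cmp; <-asym; module ≤-Reasoning )
open import Algebra.Properties.CommutativeMonoid.Sum +-0-commutativeMonoid
  using (sum; sum-cong-≗; sum-replicate-zero; ∑-distrib-+; ∑-comm)
open import Data.Nat.Tactic.RingSolver using (solve-∀)
open import Data.Sum using (_⊎_; inj₁; inj₂; [_,_])
open import Data.Unit using (tt)
import Data.Vec as Vec
open import Data.Vec using (Vec; []; _∷_)
open import Data.Vec.Membership.Propositional using (_∈_; _∉_)
open import Data.Vec.Membership.Propositional.Properties using (∈-lookup; fromAny; toAny)
open import Data.Vec.Relation.Unary.All as All using (All; []; _∷_)
open import Data.Vec.Relation.Unary.AllPairs using ([]; _∷_)
open import Data.Vec.Relation.Unary.Any as Any using (here; there)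
open import Data.Vec.Relation.Unary.Any.Properties using (lookup-index)
open import Data.Vec.Relation.Unary.Unique.Propositional using (Unique)
open import Data.Vec.Relation.Unary.Unique.Propositional.Properties using (lookup-injective)
open import Function using (_∘_)
open import Level using (0ℓ)
open import Relation.Binary using (tri<; tri≈; tri>)
open import Relation.Nullary.Decidable using (¬?; _×-dec_; decidable-stable; from-no)
open import Relation.Unary using (Pred; Decidable; _⊆_; _≐_; _∪_; _∩_; ∁; ｛_｝; U)
open import Relation.Unary.Properties using (U?; ∁?; _∩?_)

private
  variable
    A B : Set
    m n : ℕ

𝟙 : Dec A → ℕ
𝟙 A? = if does A? then 1 else 0

count : {P : Pred (Fin n) 0ℓ} → Decidable P → ℕ
count P? = sum (λ i → 𝟙 (P? i))

sum-const : ∀ n k → sum {n} (λ _ → k) ≡ n * k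
sum-const zero    k = refl
sum-const (suc n) k = cong (k +_) (sum-const n k)

sum-mono-≤ : {f g : Fin n → ℕ} → (∀ i → f i ≤ g i) → sum f ≤ sum g
sum-mono-≤ {zero}  _   = z≤n
sum-mono-≤ {suc n} f≤g = +-mono-≤ (f≤g zero) (sum-mono-≤ (f≤g ∘ suc))

𝟙-⊎ : {C : Set} (A? : Dec A) (B? : Dec B) (C? : Dec C) →
      (A → B ⊎ C) → (B ⊎ C → A) → (B → ¬ C) → 𝟙 A? ≡ 𝟙 B? + 𝟙 C?
𝟙-⊎ (yes _)  (yes b)  (yes c)  _     _    disjoint = contradiction c (disjoint b)
𝟙-⊎ (yes _)  (yes _)  (no _)   _     _    _        = refl
𝟙-⊎ (yes _)  (no _)   (yes _)  _     _    _        = refl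
𝟙-⊎ (yes a)  (no ¬b)  (no ¬c)  split _    _        = ⊥-elim ([ ¬b , ¬c ] (split a))
𝟙-⊎ (no ¬a)  (yes b)  _        _     join _        = contradiction (join (inj₁ b)) ¬a
𝟙-⊎ (no ¬a)  (no _)   (yes c)  _     join _        = contradiction (join (inj₂ c)) ¬a
𝟙-⊎ (no _)   (no _)   (no _)   _     _    _        = refl

count-⊎ : {P Q R : Pred (Fin n) 0ℓ} (P? : Decidable P) (Q? : Decidable Q) (R? : Decidable R) →
          P ⊆ Q ∪ R → Q ∪ R ⊆ P → (∀ {i} → Q i → ¬ R i) → count P? ≡ count Q? + count R?
count-⊎ P? Q? R? split join disjoint =
  trans (sum-cong-≗ (λ i → 𝟙-⊎ (P? i) (Q? i) (R? i) split join disjoint))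
        (∑-distrib-+ (λ i → 𝟙 (Q? i)) (λ i → 𝟙 (R? i)))

count-universal : count {n} U? ≡ n
count-universal {zero}  = refl
count-universal {suc n} = cong suc (count-universal {n})

0<count⇒∃ : {P : Pred (Fin n) 0ℓ} (P? : Decidable P) → 0 < count P? → ∃ P
0<count⇒∃ {zero}  _  ()
0<count⇒∃ {suc n} P? 0<count with P? zero
... | yes P0 = zero , P0
... | no _   = let i , Pi = 0<count⇒∃ (P? ∘ suc) 0<count in suc i , Pi

count-singleton : (j : Fin n) → count (j ≟_) ≡ 1
count-singleton {suc n} zero    = cong suc (sum-replicate-zero n)
count-singleton {suc n} (suc j) = count-singleton j

count-remove : {P : Pred (Fin n) 0ℓ} (P? : Decidable P) {j : Fin n} → P j →
               count P? ≡ suc (count (P? ∩? ∁? (j ≟_)))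
count-remove {P = P} P? {j} Pj = begin
  count P?                                 ≡⟨ count-⊎ P? (P? ∩? ∁? (j ≟_)) (j ≟_) split join disjoint ⟩
  count (P? ∩? ∁? (j ≟_)) + count (j ≟_)   ≡⟨ cong (count (P? ∩? ∁? (j ≟_)) +_) (count-singleton j) ⟩
  count (P? ∩? ∁? (j ≟_)) + 1              ≡⟨ +-comm _ 1 ⟩
  suc (count (P? ∩? ∁? (j ≟_)))            ∎
  where
  open ≡-Reasoning
  split : P ⊆ (P ∩ ∁ ｛ j ｝) ∪ ｛ j ｝
  split {i} Pi with j ≟ i
  ... | yes j≡i = inj₂ j≡i
  ... | no j≢i  = inj₁ (Pi , j≢i)
  join : (P ∩ ∁ ｛ j ｝) ∪ ｛ j ｝ ⊆ P
  join (inj₁ (Pi , _)) = Pi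
  join (inj₂ refl)     = Pj
  disjoint : ∀ {i} → (P ∩ ∁ ｛ j ｝) i → ¬ j ≡ i
  disjoint = proj₂

injection⇒count≤ : {P : Pred (Fin m) 0ℓ} {Q : Pred (Fin n) 0ℓ} (P? : Decidable P) (Q? : Decidable Q)
                  (f : Fin m → Fin n) → (∀ {i} → P i → Q (f i)) →
                  (∀ {i j} → P i → P j → f i ≡ f j → i ≡ j) → count P? ≤ count Q?
injection⇒count≤ {zero}  _  _  _ _    _   = z≤n
injection⇒count≤ {suc m} {P = P} {Q} P? Q? f maps inj with P? zero
... | no _   = injection⇒count≤ (P? ∘ suc) Q? (f ∘ suc) maps (λ Pi Pj → suc-injective ∘ inj Pi Pj)
... | yes P0 = begin
  suc (count (P? ∘ suc))               ≤⟨ s≤s (injection⇒count≤ (P? ∘ suc) (Q? ∩? ∁? (f zero ≟_)) (f ∘ suc)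
                                                 maps-avoiding (λ Pi Pj → suc-injective ∘ inj Pi Pj)) ⟩
  suc (count (Q? ∩? ∁? (f zero ≟_)))   ≡⟨ count-remove Q? (maps P0) ⟨
  count Q?                             ∎
  where
  open ≤-Reasoning
  maps-avoiding : ∀ {i} → P (suc i) → (Q ∩ ∁ ｛ f zero ｝) (f (suc i))
  maps-avoiding Pi = maps Pi , 0≢1+n ∘ inj P0 Pi

involution⇒2∣count : {P : Pred (Fin n) 0ℓ} (P? : Decidable P) (f : Fin n → Fin n) →
                        (∀ {i} → P i → P (f i)) → (∀ {i} → P i → f i ≢ i) →
                        (∀ {i} → P i → f (f i) ≡ i) → 2 ∣ count P?
involution⇒2∣count {n = n} {P = P} P? f closed fixed-point-free involutive =
  divides (count Below?) (begin
    count P?                        ≡⟨ count-⊎ P? Below? Above? split join disjoint ⟩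
    count Below? + count Above?     ≡⟨ cong (count Below? +_) (≤-antisym above≤below below≤above) ⟩
    count Below? + count Below?     ≡⟨ cong (count Below? +_) (+-identityʳ _) ⟨
    2 * count Below?                ≡⟨ *-comm 2 (count Below?) ⟩
    count Below? * 2                ∎)
  where
  open ≡-Reasoning
  Below Above : Pred (Fin n) 0ℓ
  Below i = P i × toℕ i < toℕ (f i)
  Above i = P i × toℕ (f i) < toℕ i
  Below? : Decidable Below
  Below? i = P? i ×-dec (toℕ i <? toℕ (f i))
  Above? : Decidable Above
  Above? i = P? i ×-dec (toℕ (f i) <? toℕ i)
  injective : ∀ {i j} → P i → P j → f i ≡ f j → i ≡ j
  injective Pi Pj fi≡fj = trans (sym (involutive Pi)) (trans (cong f fi≡fj) (involutive Pj))
  split : P ⊆ Below ∪ Above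
  split {i} Pi with <-cmp (toℕ i) (toℕ (f i))
  ... | tri< i<fi _ _ = inj₁ (Pi , i<fi)
  ... | tri≈ _ i≡fi _ = contradiction (sym (toℕ-injective i≡fi)) (fixed-point-free Pi)
  ... | tri> _ _ fi<i = inj₂ (Pi , fi<i)
  join : Below ∪ Above ⊆ P
  join = [ proj₁ , proj₁ ]
  disjoint : ∀ {i} → Below i → ¬ Above i
  disjoint (_ , i<fi) (_ , fi<i) = <-asym i<fi fi<i
  below→above : ∀ {i} → Below i → Above (f i)
  below→above {i} (Pi , i<fi) = closed Pi , subst (λ k → toℕ k < toℕ (f i)) (sym (involutive Pi)) i<fi
  above→below : ∀ {i} → Above i → Below (f i)
  above→below {i} (Pi , fi<i) = closed Pi , subst (λ k → toℕ (f i) < toℕ k) (sym (involutive Pi)) fi<i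
  below≤above : count Below? ≤ count Above?
  below≤above = injection⇒count≤ Below? Above? f below→above (λ Bi Bj → injective (proj₁ Bi) (proj₁ Bj))
  above≤below : count Above? ≤ count Below?
  above≤below = injection⇒count≤ Above? Below? f above→below (λ Ai Aj → injective (proj₁ Ai) (proj₁ Aj))

length-filter-tabulate : {P : Pred A 0ℓ} (P? : Decidable P) (f : Fin n → A) →
                         length (filter P? (tabulate f)) ≡ count (P? ∘ f)
length-filter-tabulate {n = zero}  _  _ = refl
length-filter-tabulate {n = suc n} P? f with does (P? (f zero))
... | true  = cong suc (length-filter-tabulate P? (f ∘ suc))
... | false = length-filter-tabulate P? (f ∘ suc)

length-filter-cartesianProduct : {P : Pred (A × B) 0ℓ} (P? : Decidable P) (f : Fin m → A) (g : Fin n → B) →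
  length (filter P? (cartesianProduct (tabulate f) (tabulate g))) ≡ sum (λ i → count (λ j → P? (f i , g j)))
length-filter-cartesianProduct {m = zero}  _  _ _ = refl
length-filter-cartesianProduct {A = A} {B = B} {m = suc m} P? f g = begin
  length (filter P? (row ++ rest))                        ≡⟨ cong length (filter-++ P? row rest) ⟩
  length (filter P? row ++ filter P? rest)                ≡⟨ length-++ (filter P? row) ⟩
  length (filter P? row) + length (filter P? rest)        ≡⟨ cong (_+ length (filter P? rest)) row-count ⟩
  count (λ j → P? (f zero , g j)) + length (filter P? rest)
    ≡⟨ cong (count (λ j → P? (f zero , g j)) +_) (length-filter-cartesianProduct P? (f ∘ suc) g) ⟩
  sum (λ i → count (λ j → P? (f i , g j)))                ∎
  where
  open ≡-Reasoning
  row rest : List (A × B)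
  row  = map (f zero ,_) (tabulate g)
  rest = cartesianProduct (tabulate (f ∘ suc)) (tabulate g)
  row-count : length (filter P? row) ≡ count (λ j → P? (f zero , g j))
  row-count = trans (cong (length ∘ filter P?) (map-tabulate g (f zero ,_))) (length-filter-tabulate P? ((f zero ,_) ∘ g))

unique-⊆⇒≤ : {xs : Vec A m} {ys : Vec A n} → Unique xs → (∀ {x} → x ∈ xs → x ∈ ys) → m ≤ n
unique-⊆⇒≤ {m = m} {n = n} {xs} {ys} xs-unique xs⊆ys = injective⇒≤ position-injective
  where
  open ≡-Reasoning
  position : Fin m → Fin n
  position i = Any.index (xs⊆ys (∈-lookup i xs))
  position-injective : ∀ {i j} → position i ≡ position j → i ≡ j
  position-injective {i} {j} eq = lookup-injective xs-unique i j (begin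
    Vec.lookup xs i            ≡⟨ lookup-index (xs⊆ys (∈-lookup i xs)) ⟩
    Vec.lookup ys (position i) ≡⟨ cong (Vec.lookup ys) eq ⟩
    Vec.lookup ys (position j) ≡⟨ lookup-index (xs⊆ys (∈-lookup j xs)) ⟨
    Vec.lookup xs j            ∎)

module _ {v : ℕ} where

  points : NestedBlock v → Vec (Fin v) 4
  points B = a B ∷ b B ∷ c B ∷ d B ∷ []

  points-unique : (B : NestedBlock v) → Unique (points B)
  points-unique B = (a≢b B ∷ a≢c B ∷ a≢d B ∷ []) ∷ (b≢c B ∷ b≢d B ∷ []) ∷ (c≢d B ∷ []) ∷ [] ∷ []

  ∈B⇒∈points : {x : Fin v} (B : NestedBlock v) → x ∈B B → x ∈ points B
  ∈B⇒∈points B (inj₁ x≡a)                 = here x≡a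
  ∈B⇒∈points B (inj₂ (inj₁ x≡b))          = there (here x≡b)
  ∈B⇒∈points B (inj₂ (inj₂ (inj₁ x≡c)))   = there (there (here x≡c))
  ∈B⇒∈points B (inj₂ (inj₂ (inj₂ x≡d)))   = there (there (there (here x≡d)))

  ∈points⇒∈B : {x : Fin v} (B : NestedBlock v) → x ∈ points B → x ∈B B
  ∈points⇒∈B B (here x≡a)                        = inj₁ x≡a
  ∈points⇒∈B B (there (here x≡b))                = inj₂ (inj₁ x≡b)
  ∈points⇒∈B B (there (there (here x≡c)))        = inj₂ (inj₂ (inj₁ x≡c))
  ∈points⇒∈B B (there (there (there (here x≡d)))) = inj₂ (inj₂ (inj₂ x≡d))

  block-point-outside : (B : NestedBlock v) (xs : Vec (Fin v) 3) → ∃ λ u → u ∈B B × u ∉ xs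
  block-point-outside B xs with Any.any? (λ u → ¬? (Any.any? (u ≟_) xs)) (points B)
  ... | yes outside = let u , u∈B , u∉xs = fromAny outside in u , ∈points⇒∈B B u∈B , u∉xs
  ... | no none     = contradiction (unique-⊆⇒≤ (points-unique B) inside) 1+n≰n
    where
    inside : ∀ {u} → u ∈ points B → u ∈ xs
    inside u∈B = decidable-stable (Any.any? (_ ≟_) xs) (none ∘ toAny u∈B)

  block-fourth-unique : {x y z u t : Fin v} (B : NestedBlock v) →
    Unique (x ∷ y ∷ z ∷ u ∷ []) → All (_∈B B) (x ∷ y ∷ z ∷ u ∷ []) →
    t ∈B B → t ≢ x → t ≢ y → t ≢ z → t ≡ u
  block-fourth-unique {x} {y} {z} {u} {t} B distinct members t∈B t≢x t≢y t≢z with t ≟ u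
  ... | yes t≡u = t≡u
  ... | no t≢u  = contradiction (unique-⊆⇒≤ ((t≢x ∷ t≢y ∷ t≢z ∷ t≢u ∷ []) ∷ distinct) inside) 1+n≰n
    where
    inside : ∀ {s} → s ∈ t ∷ x ∷ y ∷ z ∷ u ∷ [] → s ∈ points B
    inside (here refl) = ∈B⇒∈points B t∈B
    inside (there s∈)  = ∈B⇒∈points B (All.lookup members s∈)

  block-partner : {x : Fin v} (B : NestedBlock v) → x ∈B B → ∃ λ y → y ∈B B × x ≢ y × PairOf x y B
  block-partner B (inj₁ refl)               = b B , inj₂ (inj₁ refl) , a≢b B , inj₁ (inj₁ (refl , refl))
  block-partner B (inj₂ (inj₁ refl))        = a B , inj₁ refl , a≢b B ∘ sym , inj₁ (inj₂ (refl , refl))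
  block-partner B (inj₂ (inj₂ (inj₁ refl))) = d B , inj₂ (inj₂ (inj₂ refl)) , c≢d B , inj₂ (inj₁ (refl , refl))
  block-partner B (inj₂ (inj₂ (inj₂ refl))) = c B , inj₂ (inj₂ (inj₁ refl)) , c≢d B ∘ sym , inj₂ (inj₂ (refl , refl))

module NDPairs {v : ℕ} (𝓑 : List (NestedBlock v)) where

  ND : Fin v → Pred (Fin v) 0ℓ
  ND x y = 1 ≤ multiplicity 𝓑 x y

  ND? : (x : Fin v) → Decidable (ND x)
  ND? x y = 1 ≤? multiplicity 𝓑 x y

  PairOf-sym : {x y : Fin v} (B : NestedBlock v) → PairOf x y B → PairOf y x B
  PairOf-sym _ (inj₁ (inj₁ (x≡a , y≡b))) = inj₁ (inj₂ (y≡b , x≡a))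
  PairOf-sym _ (inj₁ (inj₂ (x≡b , y≡a))) = inj₁ (inj₁ (y≡a , x≡b))
  PairOf-sym _ (inj₂ (inj₁ (x≡c , y≡d))) = inj₂ (inj₂ (y≡d , x≡c))
  PairOf-sym _ (inj₂ (inj₂ (x≡d , y≡c))) = inj₂ (inj₁ (y≡c , x≡d))

  PairOf-irrefl : {x : Fin v} (B : NestedBlock v) → ¬ PairOf x x B
  PairOf-irrefl B (inj₁ (inj₁ (x≡a , x≡b))) = a≢b B (trans (sym x≡a) x≡b)
  PairOf-irrefl B (inj₁ (inj₂ (x≡b , x≡a))) = a≢b B (trans (sym x≡a) x≡b)
  PairOf-irrefl B (inj₂ (inj₁ (x≡c , x≡d))) = c≢d B (trans (sym x≡c) x≡d)
  PairOf-irrefl B (inj₂ (inj₂ (x≡d , x≡c))) = c≢d B (trans (sym x≡c) x≡d)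

  ND-sym : {x y : Fin v} → ND x y → ND y x
  ND-sym {x} {y} = subst (1 ≤_) (cong length (filter-≐ (pairOf? x y) (pairOf? y x) sym-≐ 𝓑))
    where
    sym-≐ : PairOf x y ≐ PairOf y x
    sym-≐ = (λ {B} → PairOf-sym B) , (λ {B} → PairOf-sym B)

  ND⇒≢ : {x y : Fin v} → ND x y → x ≢ y
  ND⇒≢ {x} xx refl = 1+n≰n (subst (1 ≤_) (cong length (filter-none (pairOf? x x) (ListAll.universal PairOf-irrefl 𝓑))) xx)

  PairOf⇒ND : {x y : Fin v} (i : Fin (length 𝓑)) → PairOf x y (lookup 𝓑 i) → ND x y
  PairOf⇒ND {x} {y} i pair = filter-some (pairOf? x y) (ListMembership.lose (ListMembership.∈-lookup {xs = 𝓑} i) pair)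

  OrderedND : Pred (Fin v × Fin v) 0ℓ
  OrderedND (x , y) = toℕ x < toℕ y × ND x y

  OrderedND? : Decidable OrderedND
  OrderedND? (x , y) = (toℕ x <? toℕ y) ×-dec ND? x y

  numNDPairs≡sum : numNDPairs 𝓑 ≡ sum (λ x → count (λ y → OrderedND? (x , y)))
  numNDPairs≡sum = length-filter-cartesianProduct OrderedND? (λ x → x) (λ y → y)

module NestedSQS {v : ℕ} (𝓑 : List (NestedBlock v)) (sqs : IsNestedSQS v 𝓑) where

  open NDPairs 𝓑

  block : Fin (length 𝓑) → NestedBlock v
  block = lookup 𝓑

  private
    variable
      x y z u w : Fin v
      i j : Fin (length 𝓑)

  triple-block-unique : x ≢ y → x ≢ z → y ≢ z →
                         TripleIn x y z (block i) → TripleIn x y z (block j) → i ≡ j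
  triple-block-unique {x} {y} {z} x≢y x≢z y≢z xyz∈i xyz∈j =
    let _ , _ , unique = sqs x y z x≢y x≢z y≢z in trans (unique _ xyz∈i) (sym (unique _ xyz∈j))

  fourth : Fin v → Fin v → Fin v → Fin v
  fourth x y z with x ≟ y | x ≟ z | y ≟ z
  ... | no x≢y | no x≢z | no y≢z =
    proj₁ (block-point-outside (block (proj₁ (sqs x y z x≢y x≢z y≢z))) (x ∷ y ∷ z ∷ []))
  ... | _      | _      | _      = x    -- junk value: the triple is degenerate

  fourth-block : x ≢ y → x ≢ z → y ≢ z →
    ∃ λ i → TripleIn x y z (block i) × fourth x y z ∈B block i × fourth x y z ∉ x ∷ y ∷ z ∷ []
  fourth-block {x} {y} {z} x≢y x≢z y≢z with x ≟ y | x ≟ z | y ≟ z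
  ... | no x≢y′ | no x≢z′ | no y≢z′ =
    let i , xyz∈i , _ = sqs x y z x≢y′ x≢z′ y≢z′
    in  i , xyz∈i , proj₂ (block-point-outside (block i) (x ∷ y ∷ z ∷ []))
  ... | yes x≡y | _       | _       = contradiction x≡y x≢y
  ... | no _    | yes x≡z | _       = contradiction x≡z x≢z
  ... | no _    | no _    | yes y≡z = contradiction y≡z y≢z

  fourth-≢ : x ≢ y → x ≢ z → y ≢ z → fourth x y z ≢ x × fourth x y z ≢ y × fourth x y z ≢ z
  fourth-≢ x≢y x≢z y≢z =
    let _ , _ , _ , f∉ = fourth-block x≢y x≢z y≢z in f∉ ∘ here , f∉ ∘ there ∘ here , f∉ ∘ there ∘ there ∘ here

  fourth-unique : x ≢ y → x ≢ z → y ≢ z → TripleIn x y z (block i) → u ∈B block i →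
                  u ≢ x → u ≢ y → u ≢ z → fourth x y z ≡ u
  fourth-unique {x} {y} {z} {i} {u} x≢y x≢z y≢z xyz∈i@(x∈ , y∈ , z∈) u∈ u≢x u≢y u≢z
    with j , xyz∈j , f∈j , _ ← fourth-block x≢y x≢z y≢z
    with refl ← triple-block-unique x≢y x≢z y≢z xyz∈i xyz∈j
    = let f≢x , f≢y , f≢z = fourth-≢ x≢y x≢z y≢z in
      block-fourth-unique (block i) distinct (x∈ ∷ y∈ ∷ z∈ ∷ u∈ ∷ []) f∈j f≢x f≢y f≢z
    where
    distinct : Unique (x ∷ y ∷ z ∷ u ∷ [])
    distinct = (x≢y ∷ x≢z ∷ ≢-sym u≢x ∷ []) ∷ (y≢z ∷ ≢-sym u≢y ∷ []) ∷ (≢-sym u≢z ∷ []) ∷ [] ∷ []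

  fourth-involutive : x ≢ y → x ≢ z → y ≢ z → fourth x y (fourth x y z) ≡ z
  fourth-involutive x≢y x≢z y≢z =
    let _ , (x∈ , y∈ , z∈) , f∈ , _ = fourth-block x≢y x≢z y≢z
        f≢x , f≢y , f≢z = fourth-≢ x≢y x≢z y≢z
    in fourth-unique x≢y (≢-sym f≢x) (≢-sym f≢y) (x∈ , y∈ , f∈) z∈ (≢-sym x≢z) (≢-sym y≢z) (≢-sym f≢z)

  fourth-comm : x ≢ y → x ≢ z → y ≢ z → fourth x z y ≡ fourth x y z
  fourth-comm x≢y x≢z y≢z =
    let _ , (x∈ , y∈ , z∈) , f∈ , _ = fourth-block x≢y x≢z y≢z
        f≢x , f≢y , f≢z = fourth-≢ x≢y x≢z y≢z
    in fourth-unique x≢z x≢y (≢-sym y≢z) (x∈ , z∈ , y∈) f∈ f≢x f≢z f≢y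

  fourth-swap : {t : Fin v} → x ≢ y → x ≢ z → y ≢ z → fourth x y z ≡ t → fourth x y t ≡ z
  fourth-swap {x} {y} x≢y x≢z y≢z refl = fourth-involutive x≢y x≢z y≢z

  fourth-injective : {z′ : Fin v} → x ≢ y → x ≢ z → y ≢ z → x ≢ z′ → y ≢ z′ →
                     fourth x y z ≡ fourth x y z′ → z ≡ z′
  fourth-injective x≢y x≢z y≢z x≢z′ y≢z′ eq =
    trans (sym (fourth-swap x≢y x≢z y≢z eq)) (fourth-involutive x≢y x≢z′ y≢z′)

  fourth-ND : x ≢ y → x ≢ z → y ≢ z → ND x y ⊎ ND x z ⊎ ND x (fourth x y z)
  fourth-ND {x} {y} {z} x≢y x≢z y≢z
    with i , xyz∈i@(x∈ , _ , _) , _ ← fourth-block x≢y x≢z y≢z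
    with p , p∈ , x≢p , pair ← block-partner (block i) x∈
    with p ≟ y | p ≟ z
  ... | yes refl | _        = inj₁ (PairOf⇒ND i pair)
  ... | no _     | yes refl = inj₂ (inj₁ (PairOf⇒ND i pair))
  ... | no p≢y   | no p≢z   =
    inj₂ (inj₂ (subst (ND x) (sym (fourth-unique x≢y x≢z y≢z xyz∈i p∈ (≢-sym x≢p) p≢y p≢z))
                      (PairOf⇒ND i pair)))

  NonND : Fin v → Pred (Fin v) 0ℓ
  NonND x = ∁ ｛ x ｝ ∩ ∁ (ND x)

  NonND? : (x : Fin v) → Decidable (NonND x)
  NonND? x = ∁? (x ≟_) ∩? ∁? (ND? x)

  ndDegree nonNDDegree : Fin v → ℕ
  ndDegree x    = count (ND? x)
  nonNDDegree x = count (NonND? x)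

  v≡1+ndDegree+nonNDDegree : (x : Fin v) → v ≡ suc (ndDegree x + nonNDDegree x)
  v≡1+ndDegree+nonNDDegree x = begin
    v                                  ≡⟨ count-universal ⟨
    count (U? {A = Fin v})             ≡⟨ count-remove U? {x} tt ⟩
    suc (count (U? ∩? ∁? (x ≟_)))
      ≡⟨ cong suc (count-⊎ (U? ∩? ∁? (x ≟_)) (ND? x) (NonND? x) split join disjoint) ⟩
    suc (ndDegree x + nonNDDegree x)   ∎
    where
    open ≡-Reasoning
    split : U ∩ ∁ ｛ x ｝ ⊆ ND x ∪ NonND x
    split {w} (_ , x≢w) with ND? x w
    ... | yes xw = inj₁ xw
    ... | no ¬xw = inj₂ (x≢w , ¬xw)
    join : ND x ∪ NonND x ⊆ U ∩ ∁ ｛ x ｝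
    join (inj₁ xw)        = tt , ND⇒≢ xw
    join (inj₂ (x≢w , _)) = tt , x≢w
    disjoint : ∀ {w} → ND x w → ¬ NonND x w
    disjoint xw (_ , ¬xw) = ¬xw xw

  fourth-NonND⇒ND : NonND x y → NonND x z → y ≢ z → ND x (fourth x y z)
  fourth-NonND⇒ND (x≢y , ¬xy) (x≢z , ¬xz) y≢z with fourth-ND x≢y x≢z y≢z
  ... | inj₁ xy        = contradiction xy ¬xy
  ... | inj₂ (inj₁ xz) = contradiction xz ¬xz
  ... | inj₂ (inj₂ xf) = xf

  nonNDDegree≤1+ndDegree : NonND x z → nonNDDegree x ≤ suc (ndDegree x)
  nonNDDegree≤1+ndDegree {x} {z} xz = begin
    nonNDDegree x            ≡⟨ count-remove (NonND? x) xz ⟩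
    suc (count Others?)      ≤⟨ s≤s (injection⇒count≤ Others? (ND? x) (fourth x z) maps injective) ⟩
    suc (ndDegree x)         ∎
    where
    open ≤-Reasoning
    Others : Pred (Fin v) 0ℓ
    Others = NonND x ∩ ∁ ｛ z ｝
    Others? : Decidable Others
    Others? = NonND? x ∩? ∁? (z ≟_)
    maps : ∀ {w} → Others w → ND x (fourth x z w)
    maps (xw , z≢w) = fourth-NonND⇒ND xz xw z≢w
    injective : ∀ {w w′} → Others w → Others w′ → fourth x z w ≡ fourth x z w′ → w ≡ w′
    injective ((x≢w , _) , z≢w) ((x≢w′ , _) , z≢w′) = fourth-injective (proj₁ xz) x≢w z≢w x≢w′ z≢w′

  nonNDDegree<ndDegree : ND x y → NonND x w → ¬ NonND x (fourth x y w) → nonNDDegree x < ndDegree x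
  nonNDDegree<ndDegree {x} {y} {w} xy xw@(x≢w , ¬xw) ¬xp = begin
    suc (nonNDDegree x)                   ≡⟨ cong suc (count-remove (NonND? x) xw) ⟩
    suc (suc (count Others?))             ≤⟨ s≤s (s≤s (injection⇒count≤ Others? Targets? (fourth x w) maps injective)) ⟩
    suc (suc (count Targets?))            ≡⟨ cong suc (count-remove (ND? x ∩? ∁? (y ≟_)) (xp , y≢p)) ⟨
    suc (count (ND? x ∩? ∁? (y ≟_)))      ≡⟨ count-remove (ND? x) xy ⟨
    ndDegree x                            ∎
    where
    open ≤-Reasoning
    p : Fin v
    p = fourth x y w
    Others Targets : Pred (Fin v) 0ℓ
    Others = NonND x ∩ ∁ ｛ w ｝
    Others? : Decidable Others
    Others? = NonND? x ∩? ∁? (w ≟_)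
    Targets = (ND x ∩ ∁ ｛ y ｝) ∩ ∁ ｛ p ｝
    Targets? : Decidable Targets
    Targets? = (ND? x ∩? ∁? (y ≟_)) ∩? ∁? (p ≟_)
    x≢y : x ≢ y
    x≢y = ND⇒≢ xy
    y≢w : y ≢ w
    y≢w refl = ¬xw xy
    p≢x : p ≢ x
    p≢x = proj₁ (fourth-≢ x≢y x≢w y≢w)
    y≢p : y ≢ p
    y≢p = ≢-sym (proj₁ (proj₂ (fourth-≢ x≢y x≢w y≢w)))
    xp : ND x p
    xp = decidable-stable (ND? x p) (λ ¬xp′ → ¬xp (≢-sym p≢x , ¬xp′))
    fourth-xwy : fourth x w y ≡ p
    fourth-xwy = fourth-comm x≢y x≢w y≢w
    fourth-xwp : fourth x w p ≡ y
    fourth-xwp = fourth-swap x≢w x≢y (≢-sym y≢w) fourth-xwy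
    maps : ∀ {u} → Others u → Targets (fourth x w u)
    maps {u} (xu@(x≢u , ¬xu) , w≢u) = (fourth-NonND⇒ND xw xu w≢u , y≢f) , p≢f
      where
      y≢f : y ≢ fourth x w u
      y≢f y≡f = ¬xu (subst (ND x) (trans (sym fourth-xwy) (fourth-swap x≢w x≢u w≢u (sym y≡f))) xp)
      p≢f : p ≢ fourth x w u
      p≢f p≡f = ¬xu (subst (ND x) (trans (sym fourth-xwp) (fourth-swap x≢w x≢u w≢u (sym p≡f))) xy)
    injective : ∀ {u u′} → Others u → Others u′ → fourth x w u ≡ fourth x w u′ → u ≡ u′
    injective ((x≢u , _) , w≢u) ((x≢u′ , _) , w≢u′) = fourth-injective x≢w x≢u w≢u x≢u′ w≢u′

  nonNDDegree-even-or-< : ND x y → 2 ∣ nonNDDegree x ⊎ nonNDDegree x < ndDegree x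
  nonNDDegree-even-or-< {x} {y} xy with any? (λ w → NonND? x w ×-dec ¬? (NonND? x (fourth x y w)))
  ... | yes (w , xw , ¬xp) = inj₂ (nonNDDegree<ndDegree xy xw ¬xp)
  ... | no none            = inj₁ (involution⇒2∣count (NonND? x) (fourth x y) closed
                                     (λ xw → proj₂ (proj₂ (fourth-≢ x≢y (proj₁ xw) (y≢ xw))))
                                     (λ xw → fourth-involutive x≢y (proj₁ xw) (y≢ xw)))
    where
    x≢y : x ≢ y
    x≢y = ND⇒≢ xy
    y≢ : ∀ {w} → NonND x w → y ≢ w
    y≢ (_ , ¬xw) refl = ¬xw xy
    closed : ∀ {w} → NonND x w → NonND x (fourth x y w)
    closed {w} xw = decidable-stable (NonND? x _) (λ ¬xp → none (w , xw , ¬xp))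

  ND-by-order : ∀ x y → 𝟙 (ND? x y) ≡ 𝟙 (OrderedND? (x , y)) + 𝟙 (OrderedND? (y , x))
  ND-by-order x y = 𝟙-⊎ (ND? x y) (OrderedND? (x , y)) (OrderedND? (y , x)) split join disjoint
    where
    split : ND x y → OrderedND (x , y) ⊎ OrderedND (y , x)
    split xy with <-cmp (toℕ x) (toℕ y)
    ... | tri< x<y _ _ = inj₁ (x<y , xy)
    ... | tri≈ _ x≡y _ = contradiction (toℕ-injective x≡y) (ND⇒≢ xy)
    ... | tri> _ _ y<x = inj₂ (y<x , ND-sym xy)
    join : OrderedND (x , y) ⊎ OrderedND (y , x) → ND x y
    join = [ proj₂ , ND-sym ∘ proj₂ ]
    disjoint : OrderedND (x , y) → ¬ OrderedND (y , x)
    disjoint (x<y , _) (y<x , _) = <-asym x<y y<x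

  sum-ndDegree : sum ndDegree ≡ numNDPairs 𝓑 + numNDPairs 𝓑
  sum-ndDegree = begin
    sum (λ x → count (ND? x))
      ≡⟨ sum-cong-≗ (λ x → trans (sum-cong-≗ (ND-by-order x)) (∑-distrib-+ (forward x) (backward x))) ⟩
    sum (λ x → sum (forward x) + sum (backward x))
      ≡⟨ ∑-distrib-+ (sum ∘ forward) (sum ∘ backward) ⟩
    sum (sum ∘ forward) + sum (sum ∘ backward)
      ≡⟨ cong (sum (sum ∘ forward) +_) (∑-comm backward) ⟩
    sum (sum ∘ forward) + sum (sum ∘ forward)
      ≡⟨ cong₂ _+_ numNDPairs≡sum numNDPairs≡sum ⟨
    numNDPairs 𝓑 + numNDPairs 𝓑 ∎
    where
    open ≡-Reasoning
    forward backward : Fin v → Fin v → ℕ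
    forward x y  = 𝟙 (OrderedND? (x , y))
    backward x y = 𝟙 (OrderedND? (y , x))

  ∃ndDegree< : {n : ℕ} → v ≡ n + n → 0 < n → 4 * numNDPairs 𝓑 + 2 * v ≡ v * v → ∃ λ x → ndDegree x < n
  ∃ndDegree< {n} v≡n+n 0<n minimum with any? (λ x → ndDegree x <? n)
  ... | yes small = small
  ... | no ¬small = contradiction too-large (<⇒≱ (m<m+n (4 * N) (≤-trans 0<v (m≤m+n v (v + 0)))))
    where
    open ≤-Reasoning
    N : ℕ
    N = numNDPairs 𝓑
    0<v : 0 < v
    0<v = subst (0 <_) (sym v≡n+n) (≤-trans 0<n (m≤m+n n n))
    vn≤2N : v * n ≤ N + N
    vn≤2N = begin
      v * n             ≡⟨ sum-const v n ⟨
      sum {v} (λ _ → n) ≤⟨ sum-mono-≤ (λ x → ≮⇒≥ (¬small ∘ (x ,_))) ⟩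
      sum ndDegree      ≡⟨ sum-ndDegree ⟩
      N + N             ∎
    four-halves : ∀ k → (k + k) + (k + k) ≡ 4 * k
    four-halves = solve-∀
    too-large : 4 * N + 2 * v ≤ 4 * N
    too-large = begin
      4 * N + 2 * v        ≡⟨ minimum ⟩
      v * v                ≡⟨ cong (v *_) v≡n+n ⟩
      v * (n + n)          ≡⟨ *-distribˡ-+ v n n ⟩
      v * n + v * n        ≤⟨ +-mono-≤ vn≤2N vn≤2N ⟩
      (N + N) + (N + N)    ≡⟨ four-halves N ⟩
      4 * N                ∎

  ndDegree<⇒degrees≡ : {n : ℕ} → v ≡ n + n → 0 < n → ndDegree x < n →
                   nonNDDegree x ≡ n × suc (ndDegree x) ≡ n
  ndDegree<⇒degrees≡ {x} {n} v≡n+n 0<n d<n =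
    ≤-antisym (≤-trans q≤1+d d<n) n≤q , ≤-antisym d<n (≤-trans n≤q q≤1+d)
    where
    open ≤-Reasoning
    n≤q : n ≤ nonNDDegree x
    n≤q = +-cancelˡ-≤ n n _ (begin
      n + n                                ≡⟨ v≡n+n ⟨
      v                                    ≡⟨ v≡1+ndDegree+nonNDDegree x ⟩
      suc (ndDegree x) + nonNDDegree x     ≤⟨ +-monoˡ-≤ (nonNDDegree x) d<n ⟩
      n + nonNDDegree x                    ∎)
    q≤1+d : nonNDDegree x ≤ suc (ndDegree x)
    q≤1+d = nonNDDegree≤1+ndDegree (proj₂ (0<count⇒∃ (NonND? x) (≤-trans 0<n n≤q)))

  numNDPairs≢minimum : {n : ℕ} → v ≡ n + n → ¬ 2 ∣ n → 2 ≤ n → 4 * numNDPairs 𝓑 + 2 * v ≢ v * v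
  numNDPairs≢minimum {n} v≡n+n n-odd 2≤n minimum
    with 0<n ← ≤-trans (s≤s z≤n) 2≤n
    with x , d<n ← ∃ndDegree< v≡n+n 0<n minimum
    with q≡n , 1+d≡n ← ndDegree<⇒degrees≡ v≡n+n 0<n d<n
    with nonNDDegree-even-or-< (proj₂ (0<count⇒∃ (ND? x) (≤-pred (subst (2 ≤_) (sym 1+d≡n) 2≤n))))
  ... | inj₁ 2∣q = n-odd (subst (2 ∣_) q≡n 2∣q)
  ... | inj₂ q<d = <⇒≱ q<d (≤-trans (n≤1+n _) (≤-reflexive (trans 1+d≡n (sym q≡n))))

%12≡10⇒twice-odd : {v : ℕ} → v % 12 ≡ 10 → ∃ λ n → v ≡ n + n × ¬ 2 ∣ n × 2 ≤ n
%12≡10⇒twice-odd {v} v%12≡10 = half , v≡half+half , half-odd , ≤-trans (s≤s (s≤s z≤n)) (m≤n+m 5 (q * 6))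
  where
  open ≡-Reasoning
  q half : ℕ
  q    = v / 12
  half = q * 6 + 5
  halve : ∀ q → 10 + q * 12 ≡ (q * 6 + 5) + (q * 6 + 5)
  halve = solve-∀
  v≡half+half : v ≡ half + half
  v≡half+half = begin
    v                 ≡⟨ m≡m%n+[m/n]*n v 12 ⟩
    v % 12 + q * 12   ≡⟨ cong (_+ q * 12) v%12≡10 ⟩
    10 + q * 12       ≡⟨ halve q ⟩
    half + half       ∎
  half-odd : ¬ 2 ∣ half
  half-odd 2∣half = from-no (2 ∣? 5) (∣m+n∣m⇒∣n 2∣half (∣-trans (divides 3 refl) (n∣m*n q)))

corollary4p5 : (v : ℕ) → v % 12 ≡ 10 →
    ¬ Σ (List (NestedBlock v)) (λ 𝓑 → IsMinUniformNestedSQS v 𝓑)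
corollary4p5 v v%12≡10 (𝓑 , sqs , _ , minimum) =
  let n , v≡n+n , n-odd , 2≤n = %12≡10⇒twice-odd v%12≡10
  in NestedSQS.numNDPairs≢minimum 𝓑 sqs v≡n+n n-odd 2≤n minimum
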